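{- Let $\mathbf{A}\in V(\mathsf{BCA})$. Then: (1) $\mathbf{A}\models J_2x\approx x$ if and only if the involutive bisemilattice reduct $\langle A,\wedge,\vee,\neg,0,1\rangle$ of $\mathbf{A}$ is a Boolean algebra; (2) $\mathbf{A}\models J_2x\approx1$ if and only if the involutive bisemilattice reduct of $\mathbf{A}$ is a semilattice (i.e. satisfies $x\vee y\approx x\wedge y$, equivalently $\neg x\approx x$, equivalently $0\approx 1$).
   Context: $\mathbf{WK}^e$ is the algebra on $\{0,\tfrac12,1\}$ of type $\langle\wedge,\vee,\neg,J_2,0,1\rangle$ with $\neg0=1,\neg\tfrac12=\tfrac12,\neg1=0$; $\vee,\wedge$ Boolean on $\{0,1\}$ and outputting $\tfrac12$ whenever an argument is $\tfrac12$; $J_21=1$, $J_2\tfrac12=J_20=0$. $\mathsf{BCA}=ISP(\mathbf{WK}^e)$ and $V(\mathsf{BCA})$ is the variety it generates. An involutive bisemilattice is an algebra $\langle A,\wedge,\vee,\neg,0,1\rangle$ satisfying $x\vee x\approx x$, $x\vee y\approx y\vee x$, $x\vee(y\vee z)\approx(x\vee y)\vee z$, $\neg\neg x\approx x$, $x\wedge y\approx\neg(\neg x\vee\neg y)$, $x\wedge(\neg x\vee y)\approx x\wedge y$, $0\vee x\approx x$, $1\approx\neg0$; the $J_2$-free reduct of any member of $V(\mathsf{BCA})$ is one. -}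

module Defs where

open import Data.Nat using (ℕ)
open import Data.Product using (_×_)
open import Relation.Binary.PropositionalEquality using (_≡_)
import Algebra.Lattice.Structures as LS

record Alg : Set₁ where
  field
    Carrier : Set
    _∧_ _∨_ : Carrier → Carrier → Carrier
    ¬_ J₂   : Carrier → Carrier
    𝟘 𝟙     : Carrier

data Three : Set where
  o h i : Three   -- 0, ½, 1

∨₃ : Three → Three → Three
∨₃ h _ = h
∨₃ _ h = h
∨₃ o o = o
∨₃ o i = i
∨₃ i o = i
∨₃ i i = i

∧₃ : Three → Three → Three
∧₃ h _ = h
∧₃ _ h = h
∧₃ i i = i
∧₃ i o = o
∧₃ o i = o
∧₃ o o = o

¬₃ : Three → Three
¬₃ o = i
¬₃ h = h
¬₃ i = o

J₂₃ : Three → Three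
J₂₃ i = i
J₂₃ h = o
J₂₃ o = o

WKe : Alg
WKe = record { Carrier = Three ; _∧_ = ∧₃ ; _∨_ = ∨₃ ; ¬_ = ¬₃ ; J₂ = J₂₃ ; 𝟘 = o ; 𝟙 = i }

data Term : Set where
  var       : ℕ → Term
  and or    : Term → Term → Term
  neg j2    : Term → Term
  zer one   : Term

eval : (A : Alg) → (ℕ → Alg.Carrier A) → Term → Alg.Carrier A
eval A ρ (var n)   = ρ n
eval A ρ (and s t) = Alg._∧_ A (eval A ρ s) (eval A ρ t)
eval A ρ (or s t)  = Alg._∨_ A (eval A ρ s) (eval A ρ t)
eval A ρ (neg s)   = Alg.¬_ A (eval A ρ s)
eval A ρ (j2 s)    = Alg.J₂ A (eval A ρ s)
eval A ρ zer       = Alg.𝟘 A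
eval A ρ one       = Alg.𝟙 A

_⊨_≈_ : Alg → Term → Term → Set
A ⊨ s ≈ t = ∀ (ρ : ℕ → Alg.Carrier A) → eval A ρ s ≡ eval A ρ t

-- Membership in V(BCA) = V(WK^e): by Birkhoff's HSP theorem, the variety
-- generated by WK^e is the class of algebras satisfying every identity of WK^e.
InVBCA : Alg → Set
InVBCA A = ∀ (s t : Term) → WKe ⊨ s ≈ t → A ⊨ s ≈ t

ReductIsBooleanAlgebra : Alg → Set
ReductIsBooleanAlgebra A =
  LS.IsBooleanAlgebra (_≡_ {A = Alg.Carrier A}) (Alg._∨_ A) (Alg._∧_ A) (Alg.¬_ A) (Alg.𝟙 A) (Alg.𝟘 A)

ReductIsSemilattice : Alg → Set
ReductIsSemilattice A = ∀ x y → Alg._∨_ A x y ≡ Alg._∧_ A x y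

-- Every identity of WK^e holds in A, so it suffices to find the right ones.
-- (1) If J₂ is the identity, substituting J₂x for every variable x turns a
-- Boolean law into an identity of WK^e, because J₂ only takes the values 0 and 1;
-- conversely J₂x ≈ J₂x ∨ (x ∧ ¬x) holds in WK^e, and x ∧ ¬x = 0 in a Boolean
-- algebra. (2) Both sides are equivalent to 0 = 1: J₂0 ≈ 0 and J₂x ∨ 1 ≈ 1 hold in
-- WK^e, and the term (¬z ∧ (x ∨ y)) ∨ (z ∧ (x ∧ y)) equals x ∨ y at z = 0 and
-- x ∧ y at z = 1.
module Submission where

open import Defs
open import Algebra.Lattice.Structures using (module IsBooleanAlgebra)
open import Data.Nat using (ℕ; zero; suc; _<ᵇ_)
open import Data.Bool using (T)
open import Data.Unit using (⊤)
open import Data.Product using (_×_; _,_)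
open import Function.Bundles using (_⇔_; mk⇔)
open import Function.Construct.Composition using (_⇔-∘_)
open import Function.Construct.Symmetry using (⇔-sym)
open import Relation.Binary.Definitions using (DecidableEquality)
open import Relation.Binary.PropositionalEquality
  using (_≡_; refl; sym; trans; cong; cong₂; isEquivalence; module ≡-Reasoning)
open import Relation.Nullary using (Dec; yes; no)
open import Relation.Nullary.Decidable using (True; toWitness)

_≟₃_ : DecidableEquality Three
o ≟₃ o = yes refl
h ≟₃ h = yes refl
i ≟₃ i = yes refl
o ≟₃ h = no λ ()
o ≟₃ i = no λ ()
h ≟₃ o = no λ ()
h ≟₃ i = no λ ()
i ≟₃ o = no λ ()
i ≟₃ h = no λ ()

all₃? : {P : Three → Set} → (∀ a → Dec (P a)) → Dec (∀ a → P a)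
all₃? P? with P? o | P? h | P? i
... | yes p | yes q | yes r = yes λ { o → p ; h → q ; i → r }
... | no ¬p | _     | _     = no λ ∀P → ¬p (∀P o)
... | _     | no ¬q | _     = no λ ∀P → ¬q (∀P h)
... | _     | _     | no ¬r = no λ ∀P → ¬r (∀P i)

env₃ : {X : Set} → X → X → X → ℕ → X
env₃ a b c zero          = a
env₃ a b c (suc zero)    = b
env₃ a b c (suc (suc _)) = c

x₀ x₁ x₂ : Term
x₀ = var 0
x₁ = var 1
x₂ = var 2

-- Built from ⊤, × and T so that it is solved by η for every closed term in x₀ x₁ x₂.
Ternary : Term → Set
Ternary (var n)   = T (n <ᵇ 3)
Ternary (and s t) = Ternary s × Ternary t
Ternary (or s t)  = Ternary s × Ternary t
Ternary (neg s)   = Ternary s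
Ternary (j2 s)    = Ternary s
Ternary zer       = ⊤
Ternary one       = ⊤

eval-env₃ : (A : Alg) (ρ : ℕ → Alg.Carrier A) (s : Term) → Ternary s →
            eval A ρ s ≡ eval A (env₃ (ρ 0) (ρ 1) (ρ 2)) s
eval-env₃ A ρ (var 0)   _         = refl
eval-env₃ A ρ (var 1)   _         = refl
eval-env₃ A ρ (var 2)   _         = refl
eval-env₃ A ρ (var (suc (suc (suc n)))) ()
eval-env₃ A ρ (and s t) (ts , tt) = cong₂ (Alg._∧_ A) (eval-env₃ A ρ s ts) (eval-env₃ A ρ t tt)
eval-env₃ A ρ (or s t)  (ts , tt) = cong₂ (Alg._∨_ A) (eval-env₃ A ρ s ts) (eval-env₃ A ρ t tt)
eval-env₃ A ρ (neg s)   ts        = cong (Alg.¬_ A) (eval-env₃ A ρ s ts)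
eval-env₃ A ρ (j2 s)    ts        = cong (Alg.J₂ A) (eval-env₃ A ρ s ts)
eval-env₃ A ρ zer       _         = refl
eval-env₃ A ρ one       _         = refl

WKe-valid₃? : (s t : Term) →
              Dec (∀ a b c → eval WKe (env₃ a b c) s ≡ eval WKe (env₃ a b c) t)
WKe-valid₃? s t = all₃? λ a → all₃? λ b → all₃? λ c →
  eval WKe (env₃ a b c) s ≟₃ eval WKe (env₃ a b c) t

WKe-⊨ : (s t : Term) {_ : Ternary s} {_ : Ternary t} {_ : True (WKe-valid₃? s t)} →
        WKe ⊨ s ≈ t
WKe-⊨ s t {ts} {tt} {valid} ρ = begin
  eval WKe ρ s   ≡⟨ eval-env₃ WKe ρ s ts ⟩
  eval WKe ρ₃ s  ≡⟨ toWitness valid (ρ 0) (ρ 1) (ρ 2) ⟩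
  eval WKe ρ₃ t  ≡⟨ eval-env₃ WKe ρ t tt ⟨
  eval WKe ρ t   ∎
  where
    open ≡-Reasoning
    ρ₃ = env₃ (ρ 0) (ρ 1) (ρ 2)

guardVars : Term → Term
guardVars (var n)   = j2 (var n)
guardVars (and s t) = and (guardVars s) (guardVars t)
guardVars (or s t)  = or (guardVars s) (guardVars t)
guardVars (neg s)   = neg (guardVars s)
guardVars (j2 s)    = j2 (guardVars s)
guardVars zer       = zer
guardVars one       = one

eval-guardVars : (A : Alg) → (∀ x → Alg.J₂ A x ≡ x) →
                 (ρ : ℕ → Alg.Carrier A) (s : Term) → eval A ρ (guardVars s) ≡ eval A ρ s
eval-guardVars A J ρ (var n)   = J (ρ n)
eval-guardVars A J ρ (and s t) = cong₂ (Alg._∧_ A) (eval-guardVars A J ρ s) (eval-guardVars A J ρ t)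
eval-guardVars A J ρ (or s t)  = cong₂ (Alg._∨_ A) (eval-guardVars A J ρ s) (eval-guardVars A J ρ t)
eval-guardVars A J ρ (neg s)   = cong (Alg.¬_ A) (eval-guardVars A J ρ s)
eval-guardVars A J ρ (j2 s)    = cong (Alg.J₂ A) (eval-guardVars A J ρ s)
eval-guardVars A J ρ zer       = refl
eval-guardVars A J ρ one       = refl

module _ (A : Alg) (V : InVBCA A) where
  open Alg A

  identity₃ : (s t : Term) {_ : Ternary s} {_ : Ternary t} {_ : True (WKe-valid₃? s t)} →
              ∀ x y z → eval A (env₃ x y z) s ≡ eval A (env₃ x y z) t
  identity₃ s t {ts} {tt} {valid} x y z = V s t (WKe-⊨ s t {ts} {tt} {valid}) (env₃ x y z)

  guarded-identity₃ : (∀ x → J₂ x ≡ x) → (s t : Term)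
    {_ : Ternary (guardVars s)} {_ : Ternary (guardVars t)}
    {_ : True (WKe-valid₃? (guardVars s) (guardVars t))} →
    ∀ x y z → eval A (env₃ x y z) s ≡ eval A (env₃ x y z) t
  guarded-identity₃ J s t {ts} {tt} {valid} x y z = begin
    eval A ρ s              ≡⟨ eval-guardVars A J ρ s ⟨
    eval A ρ (guardVars s)  ≡⟨ identity₃ (guardVars s) (guardVars t) {ts} {tt} {valid} x y z ⟩
    eval A ρ (guardVars t)  ≡⟨ eval-guardVars A J ρ t ⟩
    eval A ρ t              ∎
    where
      open ≡-Reasoning
      ρ = env₃ x y z

  J₂-id⇒booleanAlgebra : (∀ x → J₂ x ≡ x) → ReductIsBooleanAlgebra A
  J₂-id⇒booleanAlgebra J = record
    { isDistributiveLattice = record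
      { isLattice = record
        { isEquivalence = isEquivalence
        ; ∨-comm = λ x y → B (or x₀ x₁) (or x₁ x₀) x y x
        ; ∨-assoc = B (or (or x₀ x₁) x₂) (or x₀ (or x₁ x₂))
        ; ∨-cong = cong₂ _∨_
        ; ∧-comm = λ x y → B (and x₀ x₁) (and x₁ x₀) x y x
        ; ∧-assoc = B (and (and x₀ x₁) x₂) (and x₀ (and x₁ x₂))
        ; ∧-cong = cong₂ _∧_
        ; absorptive = (λ x y → B (or x₀ (and x₀ x₁)) x₀ x y x)
                     , (λ x y → B (and x₀ (or x₀ x₁)) x₀ x y x)
        }
      ; ∨-distrib-∧ = B (or x₀ (and x₁ x₂)) (and (or x₀ x₁) (or x₀ x₂))
                    , B (or (and x₁ x₂) x₀) (and (or x₁ x₀) (or x₂ x₀))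
      ; ∧-distrib-∨ = B (and x₀ (or x₁ x₂)) (or (and x₀ x₁) (and x₀ x₂))
                    , B (and (or x₁ x₂) x₀) (or (and x₁ x₀) (and x₂ x₀))
      }
    ; ∨-complement = (λ x → B (or (neg x₀) x₀) one x x x)
                   , (λ x → B (or x₀ (neg x₀)) one x x x)
    ; ∧-complement = (λ x → B (and (neg x₀) x₀) zer x x x)
                   , (λ x → B (and x₀ (neg x₀)) zer x x x)
    ; ¬-cong = cong ¬_
    }
    where B = guarded-identity₃ J

  booleanAlgebra⇒J₂-id : ReductIsBooleanAlgebra A → ∀ x → J₂ x ≡ x
  booleanAlgebra⇒J₂-id BA x = begin
    J₂ x                ≡⟨ identity₃ (or x₀ zer) x₀ (J₂ x) x x ⟨
    J₂ x ∨ 𝟘            ≡⟨ cong (J₂ x ∨_) (∧-complementʳ x) ⟨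
    J₂ x ∨ (x ∧ (¬ x))  ≡⟨ identity₃ (or (j2 x₀) (and x₀ (neg x₀))) x₀ x x x ⟩
    x                   ∎
    where
      open ≡-Reasoning
      open IsBooleanAlgebra BA using (∧-complementʳ)

  J₂-𝟙⇔𝟘≡𝟙 : (∀ x → J₂ x ≡ 𝟙) ⇔ (𝟘 ≡ 𝟙)
  J₂-𝟙⇔𝟘≡𝟙 = mk⇔ J₂-𝟙⇒𝟘≡𝟙 𝟘≡𝟙⇒J₂-𝟙
    where
      open ≡-Reasoning
      J₂-𝟙⇒𝟘≡𝟙 : (∀ x → J₂ x ≡ 𝟙) → 𝟘 ≡ 𝟙
      J₂-𝟙⇒𝟘≡𝟙 J = trans (sym (identity₃ (j2 zer) zer 𝟘 𝟘 𝟘)) (J 𝟘)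
      𝟘≡𝟙⇒J₂-𝟙 : 𝟘 ≡ 𝟙 → ∀ x → J₂ x ≡ 𝟙
      𝟘≡𝟙⇒J₂-𝟙 𝟘≡𝟙 x = begin
        J₂ x        ≡⟨ identity₃ (or (j2 x₀) zer) (j2 x₀) x x x ⟨
        J₂ x ∨ 𝟘    ≡⟨ cong (J₂ x ∨_) 𝟘≡𝟙 ⟩
        J₂ x ∨ 𝟙    ≡⟨ identity₃ (or (j2 x₀) one) one x x x ⟩
        𝟙           ∎

  semilattice⇔𝟘≡𝟙 : ReductIsSemilattice A ⇔ (𝟘 ≡ 𝟙)
  semilattice⇔𝟘≡𝟙 = mk⇔ semilattice⇒𝟘≡𝟙 𝟘≡𝟙⇒semilattice
    where
      open ≡-Reasoning
      semilattice⇒𝟘≡𝟙 : ReductIsSemilattice A → 𝟘 ≡ 𝟙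
      semilattice⇒𝟘≡𝟙 S = begin
        𝟘        ≡⟨ identity₃ (and zer one) zer 𝟘 𝟘 𝟘 ⟨
        𝟘 ∧ 𝟙    ≡⟨ S 𝟘 𝟙 ⟨
        𝟘 ∨ 𝟙    ≡⟨ identity₃ (or zer one) one 𝟘 𝟘 𝟘 ⟩
        𝟙        ∎
      switch : Term → Term
      switch z = or (and (neg z) (or x₀ x₁)) (and z (and x₀ x₁))
      𝟘≡𝟙⇒semilattice : 𝟘 ≡ 𝟙 → ReductIsSemilattice A
      𝟘≡𝟙⇒semilattice 𝟘≡𝟙 x y = begin
        x ∨ y                              ≡⟨ identity₃ (switch zer) (or x₀ x₁) x y y ⟨
        ((¬ 𝟘) ∧ (x ∨ y)) ∨ (𝟘 ∧ (x ∧ y))  ≡⟨ cong (λ z → ((¬ z) ∧ (x ∨ y)) ∨ (z ∧ (x ∧ y))) 𝟘≡𝟙 ⟩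
        ((¬ 𝟙) ∧ (x ∨ y)) ∨ (𝟙 ∧ (x ∧ y))  ≡⟨ identity₃ (switch one) (and x₀ x₁) x y y ⟩
        x ∧ y                              ∎

lemma4p9 : (A : Alg) → InVBCA A →
    ((∀ x → Alg.J₂ A x ≡ x) ⇔ ReductIsBooleanAlgebra A)
    × ((∀ x → Alg.J₂ A x ≡ Alg.𝟙 A) ⇔ ReductIsSemilattice A)
lemma4p9 A V =
  mk⇔ (J₂-id⇒booleanAlgebra A V) (booleanAlgebra⇒J₂-id A V) ,
  ⇔-sym (semilattice⇔𝟘≡𝟙 A V) ⇔-∘ J₂-𝟙⇔𝟘≡𝟙 A V
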